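{- Let $m,n\ge 1$ be integers with at least one of $m,n$ even, and let $G=P_m\times P_n$ be the grid graph (Cartesian product of the path $P_m$ on $m$ vertices and the path $P_n$ on $n$ vertices). Then $G$ satisfies the Union Closed Conjecture, i.e. each of the two bipartition classes of $G$ contains a rare vertex.
   Context: A maximal stable set of a graph is a set of pairwise non-adjacent vertices to which no further vertex can be added while remaining pairwise non-adjacent. A vertex is rare if it lies in at most half of the maximal stable sets of the graph. A bipartite graph is said to satisfy the Union Closed Conjecture if each of its two bipartition classes contains a rare vertex. The Cartesian product $G_1\times G_2$ has vertex set $V(G_1)\times V(G_2)$, with $(u,v)$ adjacent to $(u',v')$ iff either $u=u'$ and $vv'\in E(G_2)$, or $v=v'$ and $uu'\in E(G_1)$. -}

module Defs where

open import Data.Nat using (ℕ; zero; suc; _+_; _*_; _≤_)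
open import Data.Nat.Properties using (_≟_)
open import Data.Fin using (Fin; toℕ; combine)
open import Data.Bool using (Bool; true; false; _∧_; _∨_; not; if_then_else_)
open import Data.Vec using (Vec; []; _∷_; lookup)
open import Data.List using (List; []; _∷_; map; _++_; filter; length; allFin; foldr)
open import Data.Product using (_×_; _,_)
open import Relation.Binary.PropositionalEquality using (_≡_)
open import Relation.Nullary.Decidable using (⌊_⌋)

record Graph : Set where
  field
    N   : ℕ
    adj : Fin N → Fin N → Bool

Subset : ℕ → Set
Subset N = Vec Bool N

_∈ᵇ_ : ∀ {N} → Fin N → Subset N → Bool
v ∈ᵇ S = lookup S v

allSubsets : (N : ℕ) → List (Subset N)
allSubsets zero    = [] ∷ []
allSubsets (suc N) = map (true ∷_) (allSubsets N) ++ map (false ∷_) (allSubsets N)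

insert : ∀ {N} → Fin N → Subset N → Subset N
insert Data.Fin.zero    (_ ∷ S) = true ∷ S
insert (Data.Fin.suc v) (b ∷ S) = b ∷ insert v S

allᵇ : ∀ {A : Set} → (A → Bool) → List A → Bool
allᵇ p = foldr (λ x r → p x ∧ r) true

module _ (G : Graph) where
  open Graph G

  isStable : Subset N → Bool
  isStable S = allᵇ (λ u → allᵇ (λ w → not ((u ∈ᵇ S) ∧ (w ∈ᵇ S) ∧ adj u w)) (allFin N)) (allFin N)

  isMaximalStable : Subset N → Bool
  isMaximalStable S =
    isStable S ∧ allᵇ (λ v → (v ∈ᵇ S) ∨ not (isStable (insert v S))) (allFin N)

  maximalStableSets : List (Subset N)
  maximalStableSets = filter (λ S → isMaximalStable S Data.Bool.≟ true) (allSubsets N)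

  #MSS : ℕ
  #MSS = length maximalStableSets

  #MSS∋ : Fin N → ℕ
  #MSS∋ v = length (filter (λ S → (v ∈ᵇ S) Data.Bool.≟ true) maximalStableSets)

  Rare : Fin N → Set
  Rare v = 2 * #MSS∋ v ≤ #MSS

pathAdj : ∀ {k} → Fin k → Fin k → Bool
pathAdj i j = ⌊ suc (toℕ i) ≟ toℕ j ⌋ ∨ ⌊ suc (toℕ j) ≟ toℕ i ⌋

-- Grid graph P_m × P_n (Cartesian product); the vertex (a , b) of
-- Fin m × Fin n is encoded as  combine a b : Fin (m * n).
gridAdj : ∀ m n → Fin m → Fin n → Fin m → Fin n → Bool
gridAdj m n a b a' b' =
  (⌊ toℕ a ≟ toℕ a' ⌋ ∧ pathAdj b b') ∨ (⌊ toℕ b ≟ toℕ b' ⌋ ∧ pathAdj a a')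

Grid : ℕ → ℕ → Graph
Grid m n = record
  { N   = m * n
  ; adj = λ u v → let (a , b)   = Data.Fin.remQuot {m} n u
                      (a' , b') = Data.Fin.remQuot {m} n v
                  in gridAdj m n a b a' b' }

RareIn : ∀ m n → Fin m → Fin n → Set
RareIn m n a b = Rare (Grid m n) (combine a b)

-- The bipartition classes of the grid: parity of a + b
Even Odd : ℕ → Set
Even k = Data.Nat._%_ k 2 ≡ 0
Odd  k = Data.Nat._%_ k 2 ≡ 1

data ∃Rare (m n : ℕ) (Class : ℕ → Set) : Set where
  witness : (a : Fin m) (b : Fin n) → Class (toℕ a + toℕ b) → RareIn m n a b → ∃Rare m n Class

SatisfiesUCC : ℕ → ℕ → Set
SatisfiesUCC m n = ∃Rare m n Even × ∃Rare m n Odd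

{-# OPTIONS --safe #-}
-- No stable set contains both ends of an edge uv, so the maximal stable sets through u
-- and those through v are disjoint and one of u, v is rare.  Rarity is invariant under
-- graph automorphisms.  If m is even, the reflection (a , b) ↦ (m - 1 - a , b) of the
-- grid is an automorphism, and since m - 1 is odd it swaps the two parity classes;
-- applied to the edge (0 , 0) – (1 , 0) it carries whichever end is rare into the
-- other class.  The case of n even is the same with the roles of the factors exchanged.
module Submission where

open import Defs
open import Data.Nat using (ℕ; _≤_; _%_)
open import Data.Sum using (_⊎_)
open import Relation.Binary.PropositionalEquality using (_≡_)

open import Data.Bool as Bool using (Bool; true; false; _∧_; _∨_; not)
open import Data.Bool.Properties using (∨-comm)
open import Data.Fin as Fin using (Fin; toℕ; combine; opposite)
open import Data.Fin.Properties
  using (toℕ-injective; toℕ<n; *↔×; remQuot-combine; opposite-prop; opposite-involutive)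
open import Data.List using (List; []; _∷_; map; filter; length; allFin)
open import Data.List.Properties using (length-map; filter-≐)
open import Data.List.Membership.Propositional using (_∈_)
open import Data.List.Membership.Propositional.Properties
  using (∈-allFin; ∈-map⁺; ∈-map⁻; ∈-++⁺ˡ; ∈-++⁺ʳ)
open import Data.List.Membership.Propositional.Properties.WithK using (unique∧set⇒bag)
open import Data.List.Relation.Binary.BagAndSetEquality using (∼bag⇒↭)
open import Data.List.Relation.Binary.Permutation.Propositional using (_↭_; module PermutationReasoning)
open import Data.List.Relation.Binary.Permutation.Propositional.Properties using (↭-length; filter-↭)
open import Data.List.Relation.Unary.All as All using (All; []; _∷_)
open import Data.List.Relation.Unary.All.Properties using (all-filter)
open import Data.List.Relation.Unary.Any using (here; there)
open import Data.List.Relation.Unary.AllPairs using ([]; _∷_)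
open import Data.List.Relation.Unary.Unique.Propositional using (Unique)
import Data.List.Relation.Unary.Unique.Propositional.Properties as Unique
open import Data.Nat as ℕ using (zero; suc; _+_; _*_; z≤n; s≤s)
open import Data.Nat.DivMod using (%-distribˡ-+)
open import Data.Nat.Properties
  using (+-suc; +-identityʳ; +-cancelˡ-≡; +-cancelʳ-≡; suc-injective; ≤-total; ≤-trans;
         +-monoʳ-≤; +-comm; m≤n⇒m≤1+n; m∸n+n≡m)
open import Data.Product using (_×_; _,_; proj₁; proj₂)
open import Data.Product.Function.NonDependent.Propositional using (_×-↔_)
open import Data.Sum using (inj₁; inj₂)
open import Data.Vec using ([]; _∷_; lookup; tabulate; _[_]≔_)
open import Data.Vec.Properties
  using (∷-injectiveʳ; lookup∘tabulate; tabulate∘lookup; tabulate-cong; lookup∘updateAt; lookup∘updateAt′)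
open import Function using (_∘_)
open import Function.Bundles using (_↔_; Inverse; Injection; Equivalence; _⇔_; mk⇔; mk↔ₛ′)
import Function.Properties.Equivalence as ⇔
open import Function.Properties.Inverse using (↔-refl; ↔-sym; ↔-trans; ↔⇒↣)
open import Relation.Binary.PropositionalEquality
  using (refl; sym; trans; cong; cong₂; subst; _≢_; _≗_; module ≡-Reasoning)
open import Relation.Nullary using (Dec; yes; no; ¬_; contradiction)
open import Relation.Nullary.Decidable using (⌊_⌋; isYes≗does; does-⇔)
open import Relation.Unary using (Decidable)

module _ {A : Set} {P Q : A → Set} (P? : Decidable P) (Q? : Decidable Q) where

  length-filter-disjoint : ∀ {xs} → All (λ x → ¬ (P x × Q x)) xs →
                           length (filter P? xs) + length (filter Q? xs) ≤ length xs
  length-filter-disjoint {[]}     []             = z≤n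
  length-filter-disjoint {x ∷ xs} (¬PQx ∷ ¬PQxs) with P? x | Q? x | length-filter-disjoint ¬PQxs
  ... | yes Px | yes Qx | _  = contradiction (Px , Qx) ¬PQx
  ... | yes _  | no _   | ih = s≤s ih
  ... | no _   | yes _  | ih = subst (_≤ suc (length xs)) (sym (+-suc _ _)) (s≤s ih)
  ... | no _   | no _   | ih = m≤n⇒m≤1+n ih

filter-map : ∀ {A B : Set} {P : B → Set} (P? : Decidable P) (f : A → B) xs →
             filter P? (map f xs) ≡ map f (filter (P? ∘ f) xs)
filter-map P? f []       = refl
filter-map P? f (x ∷ xs) with Dec.does (P? (f x))
... | true  = cong (f x ∷_) (filter-map P? f xs)
... | false = filter-map P? f xs

map-↔-↭ : ∀ {A : Set} {xs : List A} (f : A ↔ A) → Unique xs → (∀ x → x ∈ xs) →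
          map (Inverse.to f) xs ↭ xs
map-↔-↭ {xs = xs} f unique complete =
  ∼bag⇒↭ (unique∧set⇒bag (Unique.map⁺ (Injection.injective (↔⇒↣ f)) unique) unique
    (λ {x} → mk⇔ (λ _ → complete _)
                 (λ _ → subst (_∈ map to xs) (strictlyInverseˡ x) (∈-map⁺ to (complete (from x))))))
  where open Inverse f

filterᵇ-cong : ∀ {A : Set} {p q : A → Bool} → p ≗ q →
               filter (λ x → p x Bool.≟ true) ≗ filter (λ x → q x Bool.≟ true)
filterᵇ-cong p≗q = filter-≐ _ _ ((λ {x} px → trans (sym (p≗q x)) px) , (λ {x} qx → trans (p≗q x) qx))

∧≡true⁻ : ∀ {x y : Bool} → x ∧ y ≡ true → x ≡ true × y ≡ true
∧≡true⁻ {true} {true} _ = refl , refl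

not-∧-true : ∀ {x y z : Bool} → x ≡ true → y ≡ true → z ≡ true → not (x ∧ y ∧ z) ≢ true
not-∧-true refl refl refl ()

true-⇔⇒≡ : ∀ {x y : Bool} → (x ≡ true ⇔ y ≡ true) → x ≡ y
true-⇔⇒≡ {true}  {true}  _   = refl
true-⇔⇒≡ {true}  {false} x⇔y = sym (Equivalence.to x⇔y refl)
true-⇔⇒≡ {false} {true}  x⇔y = Equivalence.from x⇔y refl
true-⇔⇒≡ {false} {false} _   = refl

⌊⌋-⇔ : ∀ {P Q : Set} → P ⇔ Q → (P? : Dec P) (Q? : Dec Q) → ⌊ P? ⌋ ≡ ⌊ Q? ⌋
⌊⌋-⇔ P⇔Q P? Q? = trans (isYes≗does P?) (trans (does-⇔ P⇔Q P? Q?) (sym (isYes≗does Q?)))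

to-≡-⇔ : ∀ {A B : Set} (f : A ↔ B) {x y : A} → Inverse.to f x ≡ Inverse.to f y ⇔ x ≡ y
to-≡-⇔ f = mk⇔ (Injection.injective (↔⇒↣ f)) (cong (Inverse.to f))

toℕ-≡-⇔ : ∀ {n} {i j : Fin n} → toℕ i ≡ toℕ j ⇔ i ≡ j
toℕ-≡-⇔ = mk⇔ toℕ-injective (cong toℕ)

⌊toℕ-≟⌋-to : ∀ {k} (f : Fin k ↔ Fin k) i j →
             ⌊ toℕ (Inverse.to f i) ℕ.≟ toℕ (Inverse.to f j) ⌋ ≡ ⌊ toℕ i ℕ.≟ toℕ j ⌋
⌊toℕ-≟⌋-to f i j = ⌊⌋-⇔ (⇔.trans toℕ-≡-⇔ (⇔.trans (to-≡-⇔ f) (⇔.sym toℕ-≡-⇔))) _ (toℕ i ℕ.≟ toℕ j)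

allᵇ-sound : ∀ {A : Set} (p : A → Bool) xs → allᵇ p xs ≡ true → ∀ {x} → x ∈ xs → p x ≡ true
allᵇ-sound p (y ∷ xs) all-p (here refl)  = proj₁ (∧≡true⁻ all-p)
allᵇ-sound p (y ∷ xs) all-p (there x∈xs) = allᵇ-sound p xs (proj₂ (∧≡true⁻ all-p)) x∈xs

allᵇ-complete : ∀ {A : Set} (p : A → Bool) xs → (∀ x → p x ≡ true) → allᵇ p xs ≡ true
allᵇ-complete p []       _ = refl
allᵇ-complete p (x ∷ xs) p-true rewrite p-true x = allᵇ-complete p xs p-true

allᵇ-allFin-reindex : ∀ {n} (σ : Fin n ↔ Fin n) {p q : Fin n → Bool} →
                      (∀ i → p i ≡ q (Inverse.to σ i)) → allᵇ p (allFin n) ≡ allᵇ q (allFin n)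
allᵇ-allFin-reindex {n} σ {p} {q} p≡q∘σ = true-⇔⇒≡ (mk⇔
  (λ all-p → allᵇ-complete q (allFin n) λ j →
     subst (λ k → q k ≡ true) (strictlyInverseˡ j)
           (trans (sym (p≡q∘σ (from j))) (allᵇ-sound p _ all-p (∈-allFin _))))
  (λ all-q → allᵇ-complete p (allFin n) λ i → trans (p≡q∘σ i) (allᵇ-sound q _ all-q (∈-allFin _))))
  where open Inverse σ

lookup-ext : ∀ {n} {S T : Subset n} → (∀ i → lookup S i ≡ lookup T i) → S ≡ T
lookup-ext {S = S} {T} S≗T =
  trans (sym (tabulate∘lookup S)) (trans (tabulate-cong S≗T) (tabulate∘lookup T))

insert≡[]≔ : ∀ {n} (v : Fin n) S → insert v S ≡ S [ v ]≔ true
insert≡[]≔ Fin.zero    (_ ∷ S) = refl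
insert≡[]≔ (Fin.suc v) (b ∷ S) = cong (b ∷_) (insert≡[]≔ v S)

lookup-insert : ∀ {n} (v w : Fin n) S → lookup (insert v S) w ≡ ⌊ w Fin.≟ v ⌋ ∨ lookup S w
lookup-insert v w S rewrite insert≡[]≔ v S with w Fin.≟ v
... | yes refl = lookup∘updateAt w S
... | no w≢v   = lookup∘updateAt′ w v w≢v S

preimage : ∀ {m n} → (Fin m → Fin n) → Subset n → Subset m
preimage f S = tabulate (lookup S ∘ f)

lookup-preimage : ∀ {m n} (f : Fin m → Fin n) S i → lookup (preimage f S) i ≡ lookup S (f i)
lookup-preimage f S = lookup∘tabulate (lookup S ∘ f)

preimage-inverse : ∀ {n} {f g : Fin n → Fin n} → (∀ i → g (f i) ≡ i) →
                   ∀ S → preimage f (preimage g S) ≡ S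
preimage-inverse {f = f} {g} g∘f≗id S = lookup-ext λ i → begin
  lookup (preimage f (preimage g S)) i ≡⟨ lookup-preimage f (preimage g S) i ⟩
  lookup (preimage g S) (f i)          ≡⟨ lookup-preimage g S (f i) ⟩
  lookup S (g (f i))                   ≡⟨ cong (lookup S) (g∘f≗id i) ⟩
  lookup S i                           ∎
  where open ≡-Reasoning

preimage-↔ : ∀ {n} → Fin n ↔ Fin n → Subset n ↔ Subset n
preimage-↔ σ =
  mk↔ₛ′ (preimage to) (preimage from) (preimage-inverse strictlyInverseʳ) (preimage-inverse strictlyInverseˡ)
  where open Inverse σ

allSubsets-complete : ∀ n (S : Subset n) → S ∈ allSubsets n
allSubsets-complete zero    []          = here refl
allSubsets-complete (suc n) (true ∷ S)  = ∈-++⁺ˡ (∈-map⁺ (true ∷_) (allSubsets-complete n S))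
allSubsets-complete (suc n) (false ∷ S) =
  ∈-++⁺ʳ (map (true ∷_) (allSubsets n)) (∈-map⁺ (false ∷_) (allSubsets-complete n S))

allSubsets-unique : ∀ n → Unique (allSubsets n)
allSubsets-unique zero    = [] ∷ []
allSubsets-unique (suc n) =
  Unique.++⁺ (Unique.map⁺ ∷-injectiveʳ (allSubsets-unique n))
             (Unique.map⁺ ∷-injectiveʳ (allSubsets-unique n))
             disjoint
  where
  disjoint : ∀ {S} → ¬ (S ∈ map (true ∷_) (allSubsets n) × S ∈ map (false ∷_) (allSubsets n))
  disjoint (S∈true∷ , S∈false∷) with ∈-map⁻ (true ∷_) S∈true∷ | ∈-map⁻ (false ∷_) S∈false∷
  ... | _ , _ , refl | _ , _ , ()

2*m≤m+n : ∀ {m n} → m ≤ n → 2 * m ≤ m + n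
2*m≤m+n {m} m≤n = +-monoʳ-≤ m (subst (_≤ _) (sym (+-identityʳ m)) m≤n)

2*m≤o⊎2*n≤o : ∀ {m n o} → m + n ≤ o → 2 * m ≤ o ⊎ 2 * n ≤ o
2*m≤o⊎2*n≤o {m} {n} {o} m+n≤o with ≤-total m n
... | inj₁ m≤n = inj₁ (≤-trans (2*m≤m+n m≤n) m+n≤o)
... | inj₂ n≤m = inj₂ (≤-trans (2*m≤m+n n≤m) (subst (_≤ o) (+-comm m n) m+n≤o))

module _ (G : Graph) where
  open Graph G

  stable⇒¬edge : ∀ {S u v} → isStable G S ≡ true → adj u v ≡ true → ¬ (u ∈ᵇ S ≡ true × v ∈ᵇ S ≡ true)
  stable⇒¬edge {S} {u} {v} S-stable uv (u∈S , v∈S) =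
    not-∧-true u∈S v∈S uv (allᵇ-sound _ _ (allᵇ-sound _ _ S-stable (∈-allFin u)) (∈-allFin v))

  #MSS∋-edge : ∀ {u v} → adj u v ≡ true → #MSS∋ G u + #MSS∋ G v ≤ #MSS G
  #MSS∋-edge {u} {v} uv =
    length-filter-disjoint (λ S → u ∈ᵇ S Bool.≟ true) (λ S → v ∈ᵇ S Bool.≟ true)
      (All.map (λ {S} S-mss → stable⇒¬edge {S} (proj₁ (∧≡true⁻ S-mss)) uv) (all-filter _ (allSubsets N)))

  edge-has-rare-end : ∀ {u v} → adj u v ≡ true → Rare G u ⊎ Rare G v
  edge-has-rare-end {u} {v} uv = 2*m≤o⊎2*n≤o {#MSS∋ G u} {#MSS∋ G v} (#MSS∋-edge uv)

record Automorphism (G : Graph) : Set where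
  field
    vertexPerm : Fin (Graph.N G) ↔ Fin (Graph.N G)
  open Inverse vertexPerm public using (to)
  field
    adj-to : ∀ u w → Graph.adj G (to u) (to w) ≡ Graph.adj G u w

module _ {G : Graph} (σ : Automorphism G) where
  open Graph G
  open Automorphism σ

  isStable-preimage : ∀ S → isStable G (preimage to S) ≡ isStable G S
  isStable-preimage S = allᵇ-allFin-reindex vertexPerm λ u → allᵇ-allFin-reindex vertexPerm λ w →
    cong not (cong₂ _∧_ (lookup-preimage to S u) (cong₂ _∧_ (lookup-preimage to S w) (sym (adj-to u w))))

  insert-preimage : ∀ v S → insert v (preimage to S) ≡ preimage to (insert (to v) S)
  insert-preimage v S = lookup-ext λ i → begin
    lookup (insert v (preimage to S)) i       ≡⟨ lookup-insert v i (preimage to S) ⟩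
    ⌊ i Fin.≟ v ⌋ ∨ lookup (preimage to S) i  ≡⟨ cong₂ _∨_ (⌊⌋-⇔ (⇔.sym (to-≡-⇔ vertexPerm)) _ _)
                                                          (lookup-preimage to S i) ⟩
    ⌊ to i Fin.≟ to v ⌋ ∨ lookup S (to i)     ≡⟨ lookup-insert (to v) (to i) S ⟨
    lookup (insert (to v) S) (to i)           ≡⟨ lookup-preimage to (insert (to v) S) i ⟨
    lookup (preimage to (insert (to v) S)) i  ∎
    where open ≡-Reasoning

  isMaximalStable-preimage : ∀ S → isMaximalStable G (preimage to S) ≡ isMaximalStable G S
  isMaximalStable-preimage S = cong₂ _∧_ (isStable-preimage S) (allᵇ-allFin-reindex vertexPerm λ v →
    cong₂ _∨_ (lookup-preimage to S v)
              (cong not (trans (cong (isStable G) (insert-preimage v S))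
                               (isStable-preimage (insert (to v) S)))))

  map-preimage-maximalStableSets : map (preimage to) (maximalStableSets G) ↭ maximalStableSets G
  map-preimage-maximalStableSets = begin
    map (preimage to) (filter isMSS? Sets)
      ≡⟨ cong (map (preimage to)) (filterᵇ-cong isMaximalStable-preimage Sets) ⟨
    map (preimage to) (filter (isMSS? ∘ preimage to) Sets)
      ≡⟨ filter-map isMSS? (preimage to) Sets ⟨
    filter isMSS? (map (preimage to) Sets)
      ↭⟨ filter-↭ isMSS? (map-↔-↭ (preimage-↔ vertexPerm)
                                  (allSubsets-unique N) (allSubsets-complete N)) ⟩
    filter isMSS? Sets
      ∎
    where
    open PermutationReasoning
    Sets = allSubsets N
    isMSS? = λ S → isMaximalStable G S Bool.≟ true

  #MSS∋-to : ∀ v → #MSS∋ G (to v) ≡ #MSS∋ G v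
  #MSS∋-to v = begin
    length (filter (∋? (to v)) M)
      ≡⟨ cong length (filterᵇ-cong (λ S → sym (lookup-preimage to S v)) M) ⟩
    length (filter (∋? v ∘ preimage to) M)
      ≡⟨ length-map (preimage to) (filter (∋? v ∘ preimage to) M) ⟨
    length (map (preimage to) (filter (∋? v ∘ preimage to) M))
      ≡⟨ cong length (filter-map (∋? v) (preimage to) M) ⟨
    length (filter (∋? v) (map (preimage to) M))
      ≡⟨ ↭-length (filter-↭ (∋? v) map-preimage-maximalStableSets) ⟩
    length (filter (∋? v) M)
      ∎
    where
    open ≡-Reasoning
    M = maximalStableSets G
    ∋? = λ v S → v ∈ᵇ S Bool.≟ true

  rare-to : ∀ {v} → Rare G v → Rare G (to v)
  rare-to {v} = subst (λ k → 2 * k ≤ #MSS G) (sym (#MSS∋-to v))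

identity : (G : Graph) → Automorphism G
identity G = record { vertexPerm = ↔-refl ; adj-to = λ _ _ → refl }

Path : ℕ → Graph
Path k = record { N = k ; adj = pathAdj }

1+a≡c⇔1+d≡b : ∀ {a b c d} → a + suc b ≡ c + suc d → (suc a ≡ c ⇔ suc d ≡ b)
1+a≡c⇔1+d≡b {a} {b} {c} {d} a+1+b≡c+1+d = mk⇔
  (λ { refl → sym (suc-injective (+-cancelˡ-≡ a (suc b) (suc (suc d))
                                    (trans a+1+b≡c+1+d (sym (+-suc a (suc d)))))) })
  (λ { refl → +-cancelʳ-≡ (suc d) (suc a) c (trans (sym (+-suc a (suc d))) a+1+b≡c+1+d) })

toℕ-opposite-+ : ∀ {k} (i : Fin k) → toℕ (opposite i) + suc (toℕ i) ≡ k
toℕ-opposite-+ i = trans (cong (_+ suc (toℕ i)) (opposite-prop i)) (m∸n+n≡m (toℕ<n i))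

pathAdj-opposite : ∀ {k} (i j : Fin k) → pathAdj (opposite i) (opposite j) ≡ pathAdj i j
pathAdj-opposite i j = trans (cong₂ _∨_ (reflect i j) (reflect j i)) (∨-comm ⌊ suc (toℕ j) ℕ.≟ toℕ i ⌋ _)
  where
  reflect : ∀ i j → ⌊ suc (toℕ (opposite i)) ℕ.≟ toℕ (opposite j) ⌋ ≡ ⌊ suc (toℕ j) ℕ.≟ toℕ i ⌋
  reflect i j = ⌊⌋-⇔ (1+a≡c⇔1+d≡b (trans (toℕ-opposite-+ i) (sym (toℕ-opposite-+ j))))
                     _ (suc (toℕ j) ℕ.≟ toℕ i)

reflection : ∀ k → Automorphism (Path k)
reflection k = record
  { vertexPerm = mk↔ₛ′ opposite opposite opposite-involutive opposite-involutive
  ; adj-to     = pathAdj-opposite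
  }

module _ {m n : ℕ} where
  open Automorphism

  adj-combine : ∀ a b a' b' → Graph.adj (Grid m n) (combine a b) (combine a' b') ≡ gridAdj m n a b a' b'
  adj-combine a b a' b' = cong₂ (λ x y → gridAdj m n (proj₁ x) (proj₂ x) (proj₁ y) (proj₂ y))
                                (remQuot-combine {m} {n} a b) (remQuot-combine {m} {n} a' b')

  gridAdj-to : (f : Automorphism (Path m)) (g : Automorphism (Path n)) → ∀ a b a' b' →
               gridAdj m n (to f a) (to g b) (to f a') (to g b') ≡ gridAdj m n a b a' b'
  gridAdj-to f g a b a' b' = cong₂ _∨_ (cong₂ _∧_ (⌊toℕ-≟⌋-to (vertexPerm f) a a') (adj-to g b b'))
                                       (cong₂ _∧_ (⌊toℕ-≟⌋-to (vertexPerm g) b b') (adj-to f a a'))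

  _⊗_ : Automorphism (Path m) → Automorphism (Path n) → Automorphism (Grid m n)
  f ⊗ g = record
    { vertexPerm = ↔-trans *↔× (↔-trans (vertexPerm f ×-↔ vertexPerm g) (↔-sym *↔×))
    ; adj-to     = λ u w → trans (adj-combine _ _ _ _) (gridAdj-to f g _ _ _ _)
    }

  ⊗-combine : ∀ f g a b → to (f ⊗ g) (combine a b) ≡ combine (to f a) (to g b)
  ⊗-combine f g a b =
    cong (λ x → combine (to f (proj₁ x)) (to g (proj₂ x))) (remQuot-combine {m} {n} a b)

  rareIn-⊗ : ∀ f g {a b} → RareIn m n a b → RareIn m n (to f a) (to g b)
  rareIn-⊗ f g {a} {b} = subst (Rare (Grid m n)) (⊗-combine f g a b) ∘ rare-to (f ⊗ g)

  ucc-from-swapped-edge :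
    (f : Automorphism (Path m)) (g : Automorphism (Path n)) → ∀ {a a' b b'} →
    gridAdj m n a b a' b' ≡ true →
    Even (toℕ a + toℕ b) → Odd (toℕ a' + toℕ b') →
    Odd (toℕ (to f a) + toℕ (to g b)) → Even (toℕ (to f a') + toℕ (to g b')) →
    SatisfiesUCC m n
  ucc-from-swapped-edge f g {a} {a'} {b} {b'} edge even odd odd-image even-image
    with edge-has-rare-end (Grid m n) (trans (adj-combine a b a' b') edge)
  ... | inj₁ rare = witness a b even rare , witness (to f a) (to g b) odd-image (rareIn-⊗ f g rare)
  ... | inj₂ rare = witness (to f a') (to g b') even-image (rareIn-⊗ f g rare) , witness a' b' odd rare

even⇒odd-suc : ∀ k → Even k → Odd (suc k)
even⇒odd-suc k k-even = trans (%-distribˡ-+ 1 k 2) (cong (λ r → (1 + r) % 2) k-even)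

opposite-parities : ∀ k → Even k →
                    Odd (toℕ (opposite {2 + k} Fin.zero))
                    × Even (toℕ (opposite {2 + k} (Fin.suc Fin.zero)))
opposite-parities k k-even = subst Odd (sym (opposite-prop {2 + k} Fin.zero)) (even⇒odd-suc k k-even)
                           , subst Even (sym (opposite-prop {2 + k} (Fin.suc Fin.zero))) k-even

proposition2 : (m n : ℕ) → 1 ≤ m → 1 ≤ n → (m % 2 ≡ 0 ⊎ n % 2 ≡ 0) → SatisfiesUCC m n
proposition2 (suc (suc m)) (suc n) _ _ (inj₁ m-even) =
  let odd , even = opposite-parities m m-even in
  ucc-from-swapped-edge (reflection _) (identity _) {Fin.zero} {Fin.suc Fin.zero} {Fin.zero} {Fin.zero}
    refl refl refl (subst Odd (sym (+-identityʳ (toℕ last))) odd)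
                   (subst Even (sym (+-identityʳ (toℕ penultimate))) even)
  where
  last penultimate : Fin (2 + m)
  last        = opposite Fin.zero
  penultimate = opposite (Fin.suc Fin.zero)
proposition2 (suc m) (suc (suc n)) _ _ (inj₂ n-even) =
  let odd , even = opposite-parities n n-even in
  ucc-from-swapped-edge (identity _) (reflection _) {Fin.zero} {Fin.zero} {Fin.zero} {Fin.suc Fin.zero}
    refl refl refl odd even
proposition2 (suc zero) _ _ _ (inj₁ ())
proposition2 _ (suc zero) _ _ (inj₂ ())
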